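{- Let $q\geq 3$ be a prime power, $m\geq 3$, and let $S\subseteq\mathbb{F}_q^m$ be a set with $\#S=u\,q^{n}<q^m$, where $n\geq 0$ and $u\geq 1$ are integers with $u\not\equiv 0\pmod q$. Let $v$ be an integer with $v<u$. Assume that for every affine hyperplane $H$ of $\mathbb{F}_q^m$, either $\#(S\cap H)=0$, or $\#(S\cap H)=v\,q^{n-1}$, or $\#(S\cap H)\geq u\,q^{n-1}$. Then there exists an affine hyperplane $H$ such that $S\cap H=\emptyset$ or $\#(S\cap H)=v\,q^{n-1}$.
   Context: $\mathbb{F}_q$ is the finite field with $q$ elements; hyperplanes are affine hyperplanes of $\mathbb{F}_q^m$. -}

module Defs where

open import Level using (0ℓ)
open import Algebra.Bundles using (CommutativeRing)
open import Data.Nat using (ℕ; zero; suc)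
open import Data.Fin using (Fin)
open import Data.Bool using (Bool; true; false; _∧_)
import Data.Bool
open import Data.List using (List; []; _∷_; _++_; map; concatMap; length; filter; allFin)
open import Data.Product using (Σ; ∃; _×_; _,_)
open import Relation.Nullary using (¬_; Dec; does)
open import Relation.Binary.PropositionalEquality using (_≡_)
open import Relation.Binary.Definitions using (Decidable)

-- A finite field: a commutative ring with decidable equality, 0 ≠ 1,
-- multiplicative inverses of nonzero elements, and an explicit
-- enumeration  enum : Fin size → Carrier  which is a bijection (up to ≈).
-- (size is then automatically a prime power q.)
record FiniteField : Set₁ where
  field
    cring    : CommutativeRing 0ℓ 0ℓ
  open CommutativeRing cring public 
  field
    _≟_      : Decidable _≈_
    0≉1      : ¬ (0# ≈ 1#)
    inverse  : ∀ x → ¬ (x ≈ 0#) → Σ Carrier (λ y → (x * y) ≈ 1#)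
    size     : ℕ
    enum     : Fin size → Carrier
    enum-inj : ∀ i j → enum i ≈ enum j → i ≡ j
    enum-sur : ∀ x → Σ (Fin size) (λ i → enum i ≈ x)

module _ (F : FiniteField) where
  open FiniteField F

  -- Points of F_q^m, coded through the enumeration: coordinate i is enum (x i).
  Point : ℕ → Set
  Point m = Fin m → Fin size

  allPoints : (m : ℕ) → List (Point m)
  allPoints zero    = (λ ()) ∷ []
  allPoints (suc m) =
    concatMap (λ c → map (λ x → λ { Fin.zero → c ; (Fin.suc i) → x i }) (allPoints m))
              (allFin size)

  dot : (m : ℕ) → (Fin m → Carrier) → Point m → Carrier
  dot zero    a x = 0#
  dot (suc m) a x = (a Fin.zero * enum (x Fin.zero)) + dot m (λ i → a (Fin.suc i)) (λ i → x (Fin.suc i))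

  record Hyperplane (m : ℕ) : Set where
    field
      normal   : Fin m → Carrier
      offset   : Carrier
      nonzero  : ¬ (∀ i → normal i ≈ 0#)

  _∈H_ : {m : ℕ} → Point m → Hyperplane m → Bool
  _∈H_ {m} x H = does (dot m (Hyperplane.normal H) x ≟ Hyperplane.offset H)

  card : (m : ℕ) → (Point m → Bool) → ℕ
  card m S = length (filter (λ x → S x Data.Bool.≟ true) (allPoints m))

  cardInter : (m : ℕ) → (Point m → Bool) → Hyperplane m → ℕ
  cardInter m S H = card m (λ x → S x ∧ (x ∈H H))

{-# OPTIONS --safe #-}
module Submission where

-- If no hyperplane met S in 0 or v q^(n-1) points, every hyperplane would meet S in at
-- least |S|/q points. The q parallel hyperplanes with a given normal partition S, so each
-- of them would meet S in exactly |S|/q points. Now count the pairs (a, x) with x ∈ S and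
-- a · x = 0 in two ways. By normals: a = 0 contributes |S|, each of the q^m - 1 other
-- normals |S|/q. By points: x = 0 is orthogonal to all q^m vectors a, any other x to
-- q^(m-1) of them. Comparing gives |S| = [0 ∈ S] q^m, impossible when 0 < |S| < q^m.

open import Defs
open import Algebra.Bundles using (CommutativeRing)
import Algebra.Properties.Group as GroupProperties
open import Data.Fin as Fin using (Fin)
open import Data.Fin.Properties using (∀-cons) renaming (_≟_ to _≟ᶠ_; any? to anyᶠ?)
open import Data.Nat using (ℕ; zero; suc)
open import Data.Product using (Σ; ∃; _×_; _,_; proj₁; proj₂; uncurry)
open import Function using (_∘_; _⇔_; mk⇔; Equivalence)
open import Relation.Nullary using (¬_; Dec; yes; no; does)
open import Relation.Nullary.Decidable using (map′; _×-dec_)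

module _ {c ℓ} (R : CommutativeRing c ℓ) where
  open CommutativeRing R hiding (zero)
  open GroupProperties +-group using (y≈x\\z; \\-leftDividesˡ)
  open import Relation.Binary.Reasoning.Setoid setoid

  x+y≈z⇔x≈z : ∀ {x y z} → y ≈ 0# → (x + y ≈ z) ⇔ (x ≈ z)
  x+y≈z⇔x≈z {x} {y} y≈0 = mk⇔ (trans (sym x+y≈x)) (trans x+y≈x)
    where
      x+y≈x : x + y ≈ x
      x+y≈x = trans (+-congˡ y≈0) (+-identityʳ x)

  x+y≈z⇔y≈-x+z : ∀ {x y z} → (x + y ≈ z) ⇔ (y ≈ - x + z)
  x+y≈z⇔y≈-x+z {x} {y} {z} =
    mk⇔ (y≈x\\z x y z) (λ y≈-x+z → trans (+-congˡ y≈-x+z) (\\-leftDividesˡ x z))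

  x*w≈t⇔x≈t*y : ∀ {w y x t} → w * y ≈ 1# → (x * w ≈ t) ⇔ (x ≈ t * y)
  x*w≈t⇔x≈t*y {w} {y} {x} {t} wy≈1 = mk⇔ to from
    where
      to : x * w ≈ t → x ≈ t * y
      to xw≈t = begin
        x            ≈⟨ *-identityʳ x ⟨
        x * 1#       ≈⟨ *-congˡ wy≈1 ⟨
        x * (w * y)  ≈⟨ *-assoc x w y ⟨
        (x * w) * y  ≈⟨ *-congʳ xw≈t ⟩
        t * y        ∎
      from : x ≈ t * y → x * w ≈ t
      from x≈ty = begin
        x * w        ≈⟨ *-congʳ x≈ty ⟩
        (t * y) * w  ≈⟨ *-assoc t y w ⟩
        t * (y * w)  ≈⟨ *-congˡ (trans (*-comm y w) wy≈1) ⟩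
        t * 1#       ≈⟨ *-identityʳ t ⟩
        t            ∎

module _ (F : FiniteField) where
  open FiniteField F hiding (zero)

  IsZero : ∀ {m} → Point F m → Set
  IsZero x = ∀ i → enum (x i) ≈ 0#

  zero? : ∀ {m} (x : Point F m) → Dec (IsZero x)
  zero? {zero}  x = yes λ ()
  zero? {suc m} x = map′ (uncurry ∀-cons) (λ x≈0 → x≈0 Fin.zero , x≈0 ∘ Fin.suc)
    (enum (x Fin.zero) ≟ 0# ×-dec zero? (x ∘ Fin.suc))

  dot-zeroˡ : ∀ m {a} x → (∀ i → a i ≈ 0#) → dot F m a x ≈ 0#
  dot-zeroˡ zero    x a≈0 = refl
  dot-zeroˡ (suc m) x a≈0 = trans
    (+-cong (trans (*-congʳ (a≈0 Fin.zero)) (zeroˡ _)) (dot-zeroˡ m (x ∘ Fin.suc) (a≈0 ∘ Fin.suc)))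
    (+-identityˡ 0#)

  dot-zeroʳ : ∀ m a {x} → IsZero x → dot F m a x ≈ 0#
  dot-zeroʳ zero    a x≈0 = refl
  dot-zeroʳ (suc m) a x≈0 = trans
    (+-cong (trans (*-congˡ (x≈0 Fin.zero)) (zeroʳ _)) (dot-zeroʳ m (a ∘ Fin.suc) (x≈0 ∘ Fin.suc)))
    (+-identityˡ 0#)

-- Imported only here: the ring operations opened above would clash with those of ℕ.
open import Algebra.Properties.CommutativeSemigroup using (interchange)
open import Data.Bool using (Bool; true; false; _∧_)
import Data.Bool as Bool
open import Data.Empty using (⊥-elim)
open import Data.List using (List; []; _∷_; _++_; map; concatMap; length; filter; allFin)
open import Data.List.Properties using (length-tabulate; map-tabulate)
open import Data.List.Membership.Propositional using (_∈_; lose)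
open import Data.List.Membership.Propositional.Properties using (∈-allFin)
open import Data.List.Relation.Unary.Any using (here; there; any?; satisfied)
open import Data.Nat using (_+_; _*_; _^_; _≤_; _<_; z≤n; s≤s; >-nonZero; _<?_)
open import Data.Nat.Divisibility using (_∣_; divides; ∣⇒≤)
open import Data.Nat.Properties
  using ( +-assoc; +-identityʳ; *-identityˡ; *-identityʳ; *-zeroʳ; *-distribˡ-+; *-distribʳ-+
        ; +-cancelˡ-≡; *-cancelˡ-≡; +-monoʳ-≤; +-mono-≤; ≤-antisym; ≤-trans; ≤-reflexive
        ; +-cancelʳ-≤; <⇒≱; ≮⇒≥; *-mono-≤; m^n>0; +-commutativeSemigroup)
open import Data.Nat.Tactic.RingSolver using (solve-∀)
open import Data.Sum using (_⊎_; map₂; [_,_]′)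
open import Function using (id)
open import Relation.Binary.PropositionalEquality
open import Relation.Nullary.Decidable using (¬?; dec-true; does-⇔)
open import Relation.Unary using (Decidable)

𝟙 : Bool → ℕ
𝟙 true  = 1
𝟙 false = 0

𝟙-∧ : ∀ b c → 𝟙 (b ∧ c) ≡ 𝟙 b * 𝟙 c
𝟙-∧ true  c = sym (+-identityʳ (𝟙 c))
𝟙-∧ false c = refl

𝟙-⇔ : ∀ {P Q : Set} (P? : Dec P) (Q? : Dec Q) → P ⇔ Q → 𝟙 (does P?) ≡ 𝟙 (does Q?)
𝟙-⇔ P? Q? P⇔Q = cong 𝟙 (does-⇔ P⇔Q P? Q?)

∑ : ∀ {A : Set} → List A → (A → ℕ) → ℕ
∑ []       f = 0
∑ (x ∷ xs) f = f x + ∑ xs f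

syntax ∑ xs (λ x → e) = ∑[ x ∈ xs ] e

module _ {A : Set} where

  ∑-cong-∈ : ∀ (xs : List A) {f g : A → ℕ} → (∀ {x} → x ∈ xs → f x ≡ g x) → ∑ xs f ≡ ∑ xs g
  ∑-cong-∈ []       f≡g = refl
  ∑-cong-∈ (x ∷ xs) f≡g = cong₂ _+_ (f≡g (here refl)) (∑-cong-∈ xs (f≡g ∘ there))

  ∑-cong : ∀ (xs : List A) {f g : A → ℕ} → (∀ x → f x ≡ g x) → ∑ xs f ≡ ∑ xs g
  ∑-cong xs f≡g = ∑-cong-∈ xs (λ {x} _ → f≡g x)

  ∑-+ : ∀ (xs : List A) (f g : A → ℕ) → ∑[ x ∈ xs ] (f x + g x) ≡ ∑ xs f + ∑ xs g
  ∑-+ []       f g = refl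
  ∑-+ (x ∷ xs) f g = trans (cong (f x + g x +_) (∑-+ xs f g))
    (interchange +-commutativeSemigroup (f x) (g x) (∑ xs f) (∑ xs g))

  ∑-*ˡ : ∀ (xs : List A) k (f : A → ℕ) → ∑[ x ∈ xs ] (k * f x) ≡ k * ∑ xs f
  ∑-*ˡ []       k f = sym (*-zeroʳ k)
  ∑-*ˡ (x ∷ xs) k f = trans (cong (k * f x +_) (∑-*ˡ xs k f)) (sym (*-distribˡ-+ k (f x) _))

  ∑-*ʳ : ∀ (xs : List A) k (f : A → ℕ) → ∑[ x ∈ xs ] (f x * k) ≡ ∑ xs f * k
  ∑-*ʳ []       k f = refl
  ∑-*ʳ (x ∷ xs) k f = trans (cong (f x * k +_) (∑-*ʳ xs k f)) (sym (*-distribʳ-+ k (f x) _))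

  ∑-const : ∀ (xs : List A) k → ∑[ _ ∈ xs ] k ≡ length xs * k
  ∑-const []       k = refl
  ∑-const (x ∷ xs) k = cong (k +_) (∑-const xs k)

  ∑-++ : ∀ (xs ys : List A) (f : A → ℕ) → ∑ (xs ++ ys) f ≡ ∑ xs f + ∑ ys f
  ∑-++ []       ys f = refl
  ∑-++ (x ∷ xs) ys f = trans (cong (f x +_) (∑-++ xs ys f)) (sym (+-assoc (f x) _ _))

  ∑-map : ∀ {B : Set} (g : B → A) ys (f : A → ℕ) → ∑ (map g ys) f ≡ ∑ ys (f ∘ g)
  ∑-map g []       f = refl
  ∑-map g (y ∷ ys) f = cong (f (g y) +_) (∑-map g ys f)

  ∑-concatMap : ∀ {B : Set} (g : B → List A) ys (f : A → ℕ) →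
                ∑ (concatMap g ys) f ≡ ∑[ y ∈ ys ] ∑ (g y) f
  ∑-concatMap g []       f = refl
  ∑-concatMap g (y ∷ ys) f = trans (∑-++ (g y) _ f) (cong (∑ (g y) f +_) (∑-concatMap g ys f))

  ∑-mono-≤ : ∀ (xs : List A) {f g : A → ℕ} → (∀ x → f x ≤ g x) → ∑ xs f ≤ ∑ xs g
  ∑-mono-≤ []       f≤g = z≤n
  ∑-mono-≤ (x ∷ xs) f≤g = +-mono-≤ (f≤g x) (∑-mono-≤ xs f≤g)

  ∑-≤-≡⇒≡ : ∀ (xs : List A) {f g : A → ℕ} → (∀ x → f x ≤ g x) → ∑ xs f ≡ ∑ xs g →
            ∀ {x} → x ∈ xs → f x ≡ g x
  ∑-≤-≡⇒≡ (y ∷ ys) {f} {g} f≤g total (here refl) = ≤-antisym (f≤g y) g≤f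
    where
      g≤f : g y ≤ f y
      g≤f = +-cancelʳ-≤ (∑ ys f) (g y) (f y)
        (≤-trans (+-monoʳ-≤ (g y) (∑-mono-≤ ys f≤g)) (≤-reflexive (sym total)))
  ∑-≤-≡⇒≡ (y ∷ ys) {f} {g} f≤g total (there x∈ys) = ∑-≤-≡⇒≡ ys f≤g rest x∈ys
    where
      rest : ∑ ys f ≡ ∑ ys g
      rest = +-cancelˡ-≡ (f y) _ _
        (trans total (cong (_+ ∑ ys g) (sym (∑-≤-≡⇒≡ (y ∷ ys) f≤g total (here refl)))))

  -- s is T where P holds and T / k elsewhere, stated without division.
  𝟙-dichotomy : ∀ {P : Set} (P? : Dec P) {k s T} → (P → s ≡ T) → (¬ P → k * s ≡ T) →
                k * s + 𝟙 (does P?) * T ≡ 𝟙 (does P?) * (k * T) + T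
  𝟙-dichotomy (yes p) {k} {s} {T} s≡T _ = trans (cong (λ s → k * s + 1 * T) (s≡T p)) (swap k T)
    where
      swap : ∀ k T → k * T + 1 * T ≡ 1 * (k * T) + T
      swap = solve-∀
  𝟙-dichotomy (no ¬p) _ ks≡T = trans (+-identityʳ _) (ks≡T ¬p)

  ∑-dichotomy : ∀ (xs : List A) {P : A → Set} (P? : Decidable P) k T (s : A → ℕ) →
    (∀ {x} → x ∈ xs → P x → s x ≡ T) → (∀ {x} → x ∈ xs → ¬ P x → k * s x ≡ T) →
    k * ∑ xs s + ∑[ x ∈ xs ] 𝟙 (does (P? x)) * T ≡ ∑[ x ∈ xs ] 𝟙 (does (P? x)) * (k * T) + length xs * T
  ∑-dichotomy xs P? k T s on-P off-P = begin
    k * ∑ xs s + ∑ xs e * T                            ≡⟨ cong₂ _+_ (∑-*ˡ xs k s) (∑-*ʳ xs T e) ⟨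
    ∑[ x ∈ xs ] (k * s x) + ∑[ x ∈ xs ] (e x * T)      ≡⟨ ∑-+ xs _ _ ⟨
    ∑[ x ∈ xs ] (k * s x + e x * T)                    ≡⟨ ∑-cong-∈ xs pointwise ⟩
    ∑[ x ∈ xs ] (e x * (k * T) + T)                    ≡⟨ ∑-+ xs _ _ ⟩
    ∑[ x ∈ xs ] (e x * (k * T)) + ∑[ _ ∈ xs ] T        ≡⟨ cong₂ _+_ (∑-*ʳ xs (k * T) e) (∑-const xs T) ⟩
    ∑ xs e * (k * T) + length xs * T                   ∎
    where
      open ≡-Reasoning
      e : A → ℕ
      e x = 𝟙 (does (P? x))
      pointwise : ∀ {x} → x ∈ xs → k * s x + 𝟙 (does (P? x)) * T ≡ 𝟙 (does (P? x)) * (k * T) + T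
      pointwise {x} x∈xs = 𝟙-dichotomy (P? x) {k} (on-P x∈xs) (off-P x∈xs)

  length-filter-∧ : ∀ (p q : A → Bool) (xs : List A) →
    length (filter (λ x → (p x ∧ q x) Bool.≟ true) xs)
      ≡ ∑[ x ∈ filter (λ x → p x Bool.≟ true) xs ] 𝟙 (q x)
  length-filter-∧ p q []       = refl
  length-filter-∧ p q (x ∷ xs) with p x
  ... | false = length-filter-∧ p q xs
  ... | true with q x
  ...   | true  = cong suc (length-filter-∧ p q xs)
  ...   | false = length-filter-∧ p q xs

∑-swap : ∀ {A B : Set} (xs : List A) (ys : List B) (f : A → B → ℕ) →
         ∑[ x ∈ xs ] ∑[ y ∈ ys ] f x y ≡ ∑[ y ∈ ys ] ∑[ x ∈ xs ] f x y
∑-swap []       ys f = sym (trans (∑-const ys 0) (*-zeroʳ (length ys)))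
∑-swap (x ∷ xs) ys f =
  trans (cong (∑ ys (f x) +_) (∑-swap xs ys f)) (sym (∑-+ ys (f x) (λ y → ∑[ x ∈ xs ] f x y)))

∑-allFin-suc : ∀ n (f : Fin (suc n) → ℕ) →
               ∑ (allFin (suc n)) f ≡ f Fin.zero + ∑[ c ∈ allFin n ] f (Fin.suc c)
∑-allFin-suc n f = cong (f Fin.zero +_)
  (trans (cong (λ cs → ∑ cs f) (sym (map-tabulate id Fin.suc))) (∑-map Fin.suc (allFin n) f))

∑-allFin-const : ∀ n k → ∑[ _ ∈ allFin n ] k ≡ n * k
∑-allFin-const n k = trans (∑-const (allFin n) k) (cong (_* k) (length-tabulate {n = n} id))

∑-allFin-≟ : ∀ {n} (c₀ : Fin n) → ∑[ c ∈ allFin n ] 𝟙 (does (c ≟ᶠ c₀)) ≡ 1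
∑-allFin-≟ {suc n} c₀ = trans (∑-allFin-suc n (λ c → 𝟙 (does (c ≟ᶠ c₀)))) (by-cases c₀)
  where
    by-cases : ∀ c₀ → 𝟙 (does (Fin.zero ≟ᶠ c₀)) + ∑[ c ∈ allFin n ] 𝟙 (does (Fin.suc c ≟ᶠ c₀)) ≡ 1
    by-cases Fin.zero     = cong suc (trans (∑-allFin-const n 0) (*-zeroʳ n))
    by-cases (Fin.suc c₀) = ∑-allFin-≟ c₀

x+qy≡qx+y⇒x≡y : ∀ {q x y} → 2 ≤ q → x + q * y ≡ q * x + y → x ≡ y
x+qy≡qx+y⇒x≡y {suc (suc r)} {x} {y} (s≤s (s≤s _)) eq =
  *-cancelˡ-≡ x y (suc r) (sym (+-cancelˡ-≡ (x + y) _ _ (begin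
    (x + y) + suc r * y      ≡⟨ regroupʸ x y (suc r) ⟩
    x + suc (suc r) * y      ≡⟨ eq ⟩
    suc (suc r) * x + y      ≡⟨ regroupˣ x y (suc r) ⟩
    (x + y) + suc r * x      ∎)))
  where
    open ≡-Reasoning
    regroupʸ : ∀ x y r → (x + y) + r * y ≡ x + (1 + r) * y
    regroupʸ = solve-∀
    regroupˣ : ∀ x y r → (1 + r) * x + y ≡ (x + y) + r * x
    regroupˣ = solve-∀

double-count⇒≡ : ∀ {q L X E Q} → 2 ≤ q →
  q * L + X ≡ q * X + Q * X → q * L + E * Q ≡ E * (q * Q) + X * Q → X ≡ E * Q
double-count⇒≡ {q} {L} {X} {E} {Q} q≥2 by-normals by-points = x+qy≡qx+y⇒x≡y q≥2
  (+-cancelˡ-≡ (q * L + X * Q) _ _ (begin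
    (q * L + X * Q) + (X + q * (E * Q))          ≡⟨ regroup₁ q L X E Q ⟩
    (q * L + X) + (E * (q * Q) + X * Q)          ≡⟨ cong₂ _+_ by-normals (sym by-points) ⟩
    (q * X + Q * X) + (q * L + E * Q)            ≡⟨ regroup₂ q L X E Q ⟩
    (q * L + X * Q) + (q * X + E * Q)            ∎))
  where
    open ≡-Reasoning
    regroup₁ : ∀ q L X E Q → (q * L + X * Q) + (X + q * (E * Q)) ≡ (q * L + X) + (E * (q * Q) + X * Q)
    regroup₁ = solve-∀
    regroup₂ : ∀ q L X E Q → (q * X + Q * X) + (q * L + E * Q) ≡ (q * L + X * Q) + (q * X + E * Q)
    regroup₂ = solve-∀

module _ (F : FiniteField) where
  open FiniteField F
    using (Carrier; _≈_; 0#; _≟_; enum; enum-inj; enum-sur; inverse; size; cring)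
    renaming (sym to ≈-sym; trans to ≈-trans; _+_ to _+ᶠ_; _*_ to _*ᶠ_; -_ to -ᶠ_)

  ∑-unique-solution : ∀ {P : Fin size → Set} (P? : Decidable P) z → (∀ c → P c ⇔ enum c ≈ z) →
                      ∑[ c ∈ allFin size ] 𝟙 (does (P? c)) ≡ 1
  ∑-unique-solution {P} P? z P⇔ =
    trans (∑-cong (allFin size) λ c → 𝟙-⇔ (P? c) (c ≟ᶠ c₀) (P⇔c≡c₀ c)) (∑-allFin-≟ c₀)
    where
      c₀ : Fin size
      c₀ = proj₁ (enum-sur z)
      c₀≈z : enum c₀ ≈ z
      c₀≈z = proj₂ (enum-sur z)
      P⇔c≡c₀ : ∀ c → P c ⇔ c ≡ c₀
      P⇔c≡c₀ c = mk⇔ (λ p → enum-inj c c₀ (≈-trans (Equivalence.to (P⇔ c) p) (≈-sym c₀≈z)))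
                      (λ { refl → Equivalence.from (P⇔ c) c₀≈z })

  ∑-offsets : ∀ y → ∑[ b ∈ allFin size ] 𝟙 (does (y ≟ enum b)) ≡ 1
  ∑-offsets y = ∑-unique-solution (λ b → y ≟ enum b) y (λ b → mk⇔ ≈-sym ≈-sym)

  ∑-multiples : ∀ {w} → ¬ w ≈ 0# → ∀ t → ∑[ c ∈ allFin size ] 𝟙 (does ((enum c *ᶠ w) ≟ t)) ≡ 1
  ∑-multiples w≉0 t with inverse _ w≉0
  ... | y , wy≈1 = ∑-unique-solution (λ c → (enum c *ᶠ _) ≟ t) (t *ᶠ y) (λ c → x*w≈t⇔x≈t*y cring wy≈1)

  ∑-allPoints-suc : ∀ m (g : Fin size → Point F m → ℕ) →
    ∑[ y ∈ allPoints F (suc m) ] g (y Fin.zero) (y ∘ Fin.suc)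
      ≡ ∑[ c ∈ allFin size ] ∑[ x ∈ allPoints F m ] g c x
  ∑-allPoints-suc m g =
    trans (∑-concatMap _ (allFin size) _) (∑-cong (allFin size) λ c → ∑-map _ (allPoints F m) _)

  length-allPoints : ∀ m → length (allPoints F m) ≡ size ^ m
  length-allPoints zero    = refl
  length-allPoints (suc m) = begin
    length (allPoints F (suc m))                    ≡⟨ ones (suc m) ⟨
    ∑[ _ ∈ allPoints F (suc m) ] 1                  ≡⟨ ∑-allPoints-suc m (λ _ _ → 1) ⟩
    ∑[ _ ∈ allFin size ] ∑[ _ ∈ allPoints F m ] 1   ≡⟨ ∑-cong (allFin size) (λ _ → ones m) ⟩
    ∑[ _ ∈ allFin size ] length (allPoints F m)     ≡⟨ ∑-cong (allFin size) (λ _ → length-allPoints m) ⟩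
    ∑[ _ ∈ allFin size ] (size ^ m)                 ≡⟨ ∑-allFin-const size _ ⟩
    size ^ suc m                                    ∎
    where
      open ≡-Reasoning
      ones : ∀ m → ∑[ _ ∈ allPoints F m ] 1 ≡ length (allPoints F m)
      ones m = trans (∑-const (allPoints F m) 1) (*-identityʳ _)

  ∑-allPoints-const : ∀ m k → ∑[ _ ∈ allPoints F m ] k ≡ size ^ m * k
  ∑-allPoints-const m k = trans (∑-const (allPoints F m) k) (cong (_* k) (length-allPoints m))

  ∑-zero-points : ∀ m → ∑[ a ∈ allPoints F m ] 𝟙 (does (zero? F a)) ≡ 1
  ∑-zero-points zero    = refl
  ∑-zero-points (suc m) = begin
    ∑[ a ∈ allPoints F (suc m) ] 𝟙 (does (zero? F a))
      ≡⟨ ∑-allPoints-suc m (λ c a → 𝟙 (does (enum c ≟ 0#) ∧ does (zero? F a))) ⟩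
    ∑[ c ∈ allFin size ] ∑[ a ∈ allPoints F m ] 𝟙 (does (enum c ≟ 0#) ∧ does (zero? F a))
      ≡⟨ ∑-cong (allFin size) factor ⟩
    ∑[ c ∈ allFin size ] (zero-head c * ∑[ a ∈ allPoints F m ] 𝟙 (does (zero? F a)))
      ≡⟨ ∑-cong (allFin size) (λ c → trans (cong (zero-head c *_) (∑-zero-points m)) (*-identityʳ _)) ⟩
    ∑[ c ∈ allFin size ] zero-head c
      ≡⟨ ∑-unique-solution (λ c → enum c ≟ 0#) 0# (λ c → mk⇔ id id) ⟩
    1 ∎
    where
      open ≡-Reasoning
      zero-head : Fin size → ℕ
      zero-head c = 𝟙 (does (enum c ≟ 0#))
      factor : ∀ c → ∑[ a ∈ allPoints F m ] 𝟙 (does (enum c ≟ 0#) ∧ does (zero? F a))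
                     ≡ zero-head c * ∑[ a ∈ allPoints F m ] 𝟙 (does (zero? F a))
      factor c = trans (∑-cong (allPoints F m) λ a → 𝟙-∧ (does (enum c ≟ 0#)) (does (zero? F a)))
                       (∑-*ˡ (allPoints F m) (zero-head c) _)

  solutions : ∀ {m} → Point F m → Carrier → ℕ
  solutions {m} x t = ∑[ a ∈ allPoints F m ] 𝟙 (does (dot F m (enum ∘ a) x ≟ t))

  solutions-zero : ∀ {m} {x : Point F m} → IsZero F x → solutions x 0# ≡ size ^ m
  solutions-zero {m} {x} x≈0 = begin
    solutions x 0#                  ≡⟨ ∑-cong (allPoints F m) orthogonal ⟩
    ∑[ _ ∈ allPoints F m ] 1        ≡⟨ ∑-allPoints-const m 1 ⟩
    size ^ m * 1                    ≡⟨ *-identityʳ _ ⟩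
    size ^ m                        ∎
    where
      open ≡-Reasoning
      orthogonal : ∀ a → 𝟙 (does (dot F m (enum ∘ a) x ≟ 0#)) ≡ 1
      orthogonal a = cong 𝟙 (dec-true (dot F m (enum ∘ a) x ≟ 0#) (dot-zeroʳ F m (enum ∘ a) x≈0))

  solutions-nonzero : ∀ {m} (x : Point F m) → ¬ IsZero F x → ∀ t → size * solutions x t ≡ size ^ m
  solutions-nonzero {zero}  x x≉0 t = ⊥-elim (x≉0 λ ())
  solutions-nonzero {suc m} x x≉0 t = by-tail (zero? F x′)
    where
      open ≡-Reasoning
      x₀ : Carrier
      x₀ = enum (x Fin.zero)
      x′ : Point F m
      x′ = x ∘ Fin.suc
      head : Fin size → Carrier
      head c = enum c *ᶠ x₀
      tail : Point F m → Carrier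
      tail a = dot F m (enum ∘ a) x′

      split-first : size * solutions x t
                    ≡ size * ∑[ c ∈ allFin size ] ∑[ a ∈ allPoints F m ] 𝟙 (does ((head c +ᶠ tail a) ≟ t))
      split-first = cong (size *_) (∑-allPoints-suc m λ c a → 𝟙 (does ((head c +ᶠ tail a) ≟ t)))

      by-tail : Dec (IsZero F x′) → size * solutions x t ≡ size ^ suc m
      by-tail (yes x′≈0) = begin
        size * solutions x t
          ≡⟨ split-first ⟩
        size * ∑[ c ∈ allFin size ] ∑[ a ∈ allPoints F m ] 𝟙 (does ((head c +ᶠ tail a) ≟ t))
          ≡⟨ cong (size *_) (∑-cong (allFin size) λ c → trans (∑-cong (allPoints F m) (drop-tail c))
                                                              (∑-allPoints-const m _)) ⟩
        size * ∑[ c ∈ allFin size ] (size ^ m * 𝟙 (does (head c ≟ t)))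
          ≡⟨ cong (size *_) (∑-*ˡ (allFin size) (size ^ m) λ c → 𝟙 (does (head c ≟ t))) ⟩
        size * (size ^ m * ∑[ c ∈ allFin size ] 𝟙 (does (head c ≟ t)))
          ≡⟨ cong (λ n → size * (size ^ m * n)) (∑-multiples x₀≉0 t) ⟩
        size * (size ^ m * 1)
          ≡⟨ cong (size *_) (*-identityʳ _) ⟩
        size ^ suc m ∎
        where
          x₀≉0 : ¬ x₀ ≈ 0#
          x₀≉0 x₀≈0 = x≉0 (∀-cons x₀≈0 x′≈0)
          drop-tail : ∀ c a → 𝟙 (does ((head c +ᶠ tail a) ≟ t)) ≡ 𝟙 (does (head c ≟ t))
          drop-tail c a =
            𝟙-⇔ ((head c +ᶠ tail a) ≟ t) (head c ≟ t) (x+y≈z⇔x≈z cring (dot-zeroʳ F m (enum ∘ a) x′≈0))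
      by-tail (no x′≉0) = begin
        size * solutions x t
          ≡⟨ split-first ⟩
        size * ∑[ c ∈ allFin size ] ∑[ a ∈ allPoints F m ] 𝟙 (does ((head c +ᶠ tail a) ≟ t))
          ≡⟨ ∑-*ˡ (allFin size) size _ ⟨
        ∑[ c ∈ allFin size ] (size * ∑[ a ∈ allPoints F m ] 𝟙 (does ((head c +ᶠ tail a) ≟ t)))
          ≡⟨ ∑-cong (allFin size) (λ c → trans (cong (size *_) (move-head c))
                                                (solutions-nonzero x′ x′≉0 _)) ⟩
        ∑[ _ ∈ allFin size ] (size ^ m)
          ≡⟨ ∑-allFin-const size _ ⟩
        size ^ suc m ∎
        where
          move-head : ∀ c → ∑[ a ∈ allPoints F m ] 𝟙 (does ((head c +ᶠ tail a) ≟ t))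
                            ≡ solutions x′ (-ᶠ head c +ᶠ t)
          move-head c = ∑-cong (allPoints F m) λ a →
            𝟙-⇔ ((head c +ᶠ tail a) ≟ t) (tail a ≟ (-ᶠ head c +ᶠ t)) (x+y≈z⇔y≈-x+z cring)

  module _ {m} (S : Point F m → Bool) where

    elements : List (Point F m)
    elements = filter (λ x → S x Bool.≟ true) (allPoints F m)

    -- slice a t = #(S ∩ {x | a · x = t}); a = 0 is allowed, so this need not be a hyperplane.
    slice : Point F m → Carrier → ℕ
    slice a t = ∑[ x ∈ elements ] 𝟙 (does (dot F m (enum ∘ a) x ≟ t))

    cardInter≡slice : ∀ a a≉0 t →
      cardInter F m S record { normal = enum ∘ a ; offset = t ; nonzero = a≉0 } ≡ slice a t
    cardInter≡slice a _ t = length-filter-∧ S (λ x → does (dot F m (enum ∘ a) x ≟ t)) (allPoints F m)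

    slice-cong : ∀ a {t t′} → t ≈ t′ → slice a t ≡ slice a t′
    slice-cong a t≈t′ = ∑-cong elements λ x → 𝟙-⇔ (dot F m (enum ∘ a) x ≟ _) (dot F m (enum ∘ a) x ≟ _)
      (mk⇔ (λ e → ≈-trans e t≈t′) (λ e → ≈-trans e (≈-sym t≈t′)))

    slice-zero : ∀ {a} → IsZero F a → slice a 0# ≡ card F m S
    slice-zero {a} a≈0 = begin
      slice a 0#                ≡⟨ ∑-cong elements orthogonal ⟩
      ∑[ _ ∈ elements ] 1       ≡⟨ ∑-const elements 1 ⟩
      length elements * 1       ≡⟨ *-identityʳ _ ⟩
      card F m S                ∎
      where
        open ≡-Reasoning
        orthogonal : ∀ x → 𝟙 (does (dot F m (enum ∘ a) x ≟ 0#)) ≡ 1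
        orthogonal x = cong 𝟙 (dec-true (dot F m (enum ∘ a) x ≟ 0#) (dot-zeroˡ F m x a≈0))

    ∑-slices : ∀ a → ∑[ b ∈ allFin size ] slice a (enum b) ≡ card F m S
    ∑-slices a = begin
      ∑[ b ∈ allFin size ] slice a (enum b)
        ≡⟨ ∑-swap (allFin size) elements _ ⟩
      ∑[ x ∈ elements ] ∑[ b ∈ allFin size ] 𝟙 (does (dot F m (enum ∘ a) x ≟ enum b))
        ≡⟨ ∑-cong elements (λ x → ∑-offsets (dot F m (enum ∘ a) x)) ⟩
      ∑[ _ ∈ elements ] 1
        ≡⟨ trans (∑-const elements 1) (*-identityʳ _) ⟩
      card F m S ∎
      where open ≡-Reasoning

    large-slices⇒balanced : ∀ a → (∀ b → card F m S ≤ size * slice a (enum b)) →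
                            ∀ t → size * slice a t ≡ card F m S
    large-slices⇒balanced a large t = begin
      size * slice a t           ≡⟨ cong (size *_) (slice-cong a (≈-sym b≈t)) ⟩
      size * slice a (enum b)    ≡⟨ ∑-≤-≡⇒≡ (allFin size) large total (∈-allFin b) ⟨
      card F m S                 ∎
      where
        open ≡-Reasoning
        b : Fin size
        b = proj₁ (enum-sur t)
        b≈t : enum b ≈ t
        b≈t = proj₂ (enum-sur t)
        total : ∑[ _ ∈ allFin size ] card F m S ≡ ∑[ b ∈ allFin size ] (size * slice a (enum b))
        total = begin
          ∑[ _ ∈ allFin size ] card F m S                ≡⟨ ∑-allFin-const size _ ⟩
          size * card F m S                              ≡⟨ cong (size *_) (∑-slices a) ⟨
          size * ∑[ b ∈ allFin size ] slice a (enum b)   ≡⟨ ∑-*ˡ (allFin size) size _ ⟨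
          ∑[ b ∈ allFin size ] (size * slice a (enum b)) ∎

    -- Only enumerated normals are quantified over: without function extensionality
    -- an arbitrary point is not provably a member of allPoints.
    AllSlicesLarge : Set
    AllSlicesLarge =
      ∀ {a} → a ∈ allPoints F m → ¬ IsZero F a → ∀ b → card F m S ≤ size * slice a (enum b)

    count-by-normals : AllSlicesLarge →
      size * ∑[ a ∈ allPoints F m ] slice a 0# + card F m S ≡ size * card F m S + size ^ m * card F m S
    count-by-normals large = begin
      size * L + card F m S
        ≡⟨ cong (size * L +_) (one-zero-point _) ⟨
      size * L + Z * card F m S
        ≡⟨ ∑-dichotomy (allPoints F m) (zero? F) size (card F m S) (λ a → slice a 0#)
             (λ _ → slice-zero) (λ a∈ a≉0 → large-slices⇒balanced _ (large a∈ a≉0) 0#) ⟩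
      Z * (size * card F m S) + length (allPoints F m) * card F m S
        ≡⟨ cong₂ _+_ (one-zero-point _) (cong (_* card F m S) (length-allPoints m)) ⟩
      size * card F m S + size ^ m * card F m S ∎
      where
        open ≡-Reasoning
        L Z : ℕ
        L = ∑[ a ∈ allPoints F m ] slice a 0#
        Z = ∑[ a ∈ allPoints F m ] 𝟙 (does (zero? F a))
        one-zero-point : ∀ n → Z * n ≡ n
        one-zero-point n = trans (cong (_* n) (∑-zero-points m)) (*-identityˡ n)

    originCount : ℕ
    originCount = ∑[ x ∈ elements ] 𝟙 (does (zero? F x))

    count-by-points :
      size * ∑[ x ∈ elements ] solutions x 0# + originCount * size ^ m
        ≡ originCount * (size * size ^ m) + card F m S * size ^ m
    count-by-points = ∑-dichotomy elements (zero? F) size (size ^ m) (λ x → solutions x 0#)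
      (λ _ → solutions-zero) (λ {x} _ x≉0 → solutions-nonzero x x≉0 0#)

    not-all-slices-large : 2 ≤ size → 0 < card F m S → card F m S < size ^ m → ¬ AllSlicesLarge
    not-all-slices-large q≥2 0<|S| |S|<qᵐ large =
      <⇒≱ |S|<qᵐ (∣⇒≤ {{>-nonZero 0<|S|}} (divides originCount |S|≡originCount*qᵐ))
      where
        |S|≡originCount*qᵐ : card F m S ≡ originCount * size ^ m
        |S|≡originCount*qᵐ = double-count⇒≡ {E = originCount} q≥2 (count-by-normals large)
          (trans (cong (λ n → size * n + originCount * size ^ m) (∑-swap (allPoints F m) elements _))
                 count-by-points)

    HasSmallSlice : Point F m → Set
    HasSmallSlice a = ¬ IsZero F a × ∃ λ b → size * slice a (enum b) < card F m S

    hasSmallSlice? : Decidable HasSmallSlice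
    hasSmallSlice? a = ¬? (zero? F a) ×-dec anyᶠ? (λ b → size * slice a (enum b) <? card F m S)

    some-small-hyperplane : 2 ≤ size → 0 < card F m S → card F m S < size ^ m →
                            Σ (Hyperplane F m) λ H → size * cardInter F m S H < card F m S
    some-small-hyperplane q≥2 0<|S| |S|<qᵐ with any? hasSmallSlice? (allPoints F m)
    ... | yes found with satisfied found
    ...   | a , a≉0 , b , small =
      record { normal = enum ∘ a ; offset = enum b ; nonzero = a≉0 }
        , subst (λ n → size * n < card F m S) (sym (cardInter≡slice a a≉0 (enum b))) small
    some-small-hyperplane q≥2 0<|S| |S|<qᵐ | no none = ⊥-elim (not-all-slices-large q≥2 0<|S| |S|<qᵐ
      λ a∈ a≉0 b → ≮⇒≥ λ small → none (lose a∈ (a≉0 , b , small)))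

-- Imported last: its prefix +_ would make sections such as (k +_) ambiguous.
open import Data.Integer using (ℤ; +_) renaming (_*_ to _*ℤ_; _<_ to _<ℤ_)

lemma3p3 : (F : FiniteField) → 3 ≤ FiniteField.size F →
    (m : ℕ) → 3 ≤ m →
    (S : Point F m → Bool) → (u n : ℕ) → 1 ≤ u → ¬ (FiniteField.size F ∣ u) →
    card F m S ≡ u * FiniteField.size F ^ n →
    u * FiniteField.size F ^ n < FiniteField.size F ^ m →
    (v : ℤ) → v <ℤ + u →
    ((H : Hyperplane F m) →
      (cardInter F m S H ≡ 0)
      ⊎ ((+ (FiniteField.size F * cardInter F m S H)) ≡ v *ℤ (+ (FiniteField.size F ^ n)))
      ⊎ (u * FiniteField.size F ^ n ≤ FiniteField.size F * cardInter F m S H)) →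
    Σ (Hyperplane F m) (λ H →
      (cardInter F m S H ≡ 0)
      ⊎ ((+ (FiniteField.size F * cardInter F m S H)) ≡ v *ℤ (+ (FiniteField.size F ^ n))))
lemma3p3 F q≥3 m _ S u n u≥1 _ |S|≡uqⁿ uqⁿ<qᵐ v _ classify =
  H , map₂ [ id , ⊥-elim ∘ not-large ]′ (classify H)
  where
    open FiniteField F using (size)
    q>0 : 0 < size
    q>0 = ≤-trans (s≤s z≤n) q≥3
    0<|S| : 0 < card F m S
    0<|S| = subst (0 <_) (sym |S|≡uqⁿ) (*-mono-≤ u≥1 (m^n>0 size {{>-nonZero q>0}} n))
    small-hyperplane : Σ (Hyperplane F m) λ H → size * cardInter F m S H < card F m S
    small-hyperplane = some-small-hyperplane F S (≤-trans (s≤s (s≤s z≤n)) q≥3) 0<|S|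
                         (subst (_< size ^ m) (sym |S|≡uqⁿ) uqⁿ<qᵐ)
    H : Hyperplane F m
    H = proj₁ small-hyperplane
    not-large : ¬ (u * size ^ n ≤ size * cardInter F m S H)
    not-large large =
      <⇒≱ (proj₂ small-hyperplane) (subst (_≤ size * cardInter F m S H) (sym |S|≡uqⁿ) large)
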